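{- Let $G$ be a graph admitting a simultaneous $s$-stack $q$-queue layout. Then $G$ has pathwidth at most $2sq$.
   Context: All graphs are finite, simple and undirected. A vertex order $\sigma$ is a total order of the vertices. Two edges $(u,v)$ and $(x,y)$ cross with respect to $\sigma$ if $u <_\sigma x <_\sigma v <_\sigma y$, and nest if $u <_\sigma x <_\sigma y <_\sigma v$. A simultaneous $s$-stack $q$-queue layout of $G$ is a single vertex order $\sigma$ together with a partition of $E(G)$ into $s$ sets of pairwise non-crossing edges (stacks) and a partition of $E(G)$ into $q$ sets of pairwise non-nested edges (queues), both with respect to $\sigma$. Pathwidth is the minimum width (maximum bag size minus one) of a path decomposition. -}

module Defs where

open import Data.Nat using (ℕ; _≤_; _+_; _*_)
open import Data.Fin using (Fin; _<_)
open import Data.Fin.Subset using (Subset; _∈_; ∣_∣)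
open import Data.Bool using (Bool; true; false)
open import Data.Product using (Σ; _×_; ∃-syntax)
open import Relation.Binary.PropositionalEquality using (_≡_; _≢_)
open import Function.Definitions using (Injective)

record Graph (n : ℕ) : Set where
  field
    adj   : Fin n → Fin n → Bool
    sym   : ∀ u v → adj u v ≡ adj v u
    irrefl : ∀ u → adj u u ≡ false

open Graph public

Edge : ∀ {n} → Graph n → Fin n → Fin n → Set
Edge G u v = adj G u v ≡ true

-- A vertex order: an injective (hence bijective) map from vertices to positions.
-- u <σ v  iff  σ u < σ v.
VertexOrder : ℕ → Set
VertexOrder n = Σ (Fin n → Fin n) (λ σ → Injective _≡_ _≡_ σ)

module _ {n : ℕ} (σ : Fin n → Fin n) where
  Cross : Fin n → Fin n → Fin n → Fin n → Set
  Cross u v x y = (σ u < σ x) × (σ x < σ v) × (σ v < σ y)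

  Nest : Fin n → Fin n → Fin n → Fin n → Set
  Nest u v x y = (σ u < σ x) × (σ x < σ y) × (σ y < σ v)

-- An s-stack layout w.r.t. σ: an assignment of each edge (u,v) with u <σ v to one
-- of s stacks (the assignment's values on non-edges / wrongly oriented pairs are
-- irrelevant) such that no two edges of the same stack cross.
IsStackLayout : ∀ {n} (G : Graph n) (σ : Fin n → Fin n) (s : ℕ) →
                (Fin n → Fin n → Fin s) → Set
IsStackLayout G σ s col = ∀ u v x y → Edge G u v → Edge G x y →
  Cross σ u v x y → col u v ≢ col x y

IsQueueLayout : ∀ {n} (G : Graph n) (σ : Fin n → Fin n) (q : ℕ) →
                (Fin n → Fin n → Fin q) → Set
IsQueueLayout G σ q col = ∀ u v x y → Edge G u v → Edge G x y →
  Nest σ u v x y → col u v ≢ col x y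

SimStackQueueLayout : ∀ {n} → Graph n → ℕ → ℕ → Set
SimStackQueueLayout {n} G s q =
  Σ (VertexOrder n) λ (σ , _) →
    Σ (Fin n → Fin n → Fin s) (λ st → IsStackLayout G σ s st) ×
    Σ (Fin n → Fin n → Fin q) (λ qu → IsQueueLayout G σ q qu)
  where open import Data.Product using (_,_)

record PathDecomposition {n : ℕ} (G : Graph n) (m : ℕ) : Set where
  field
    bag        : Fin m → Subset n
    covers-v   : ∀ v → ∃[ i ] (v ∈ bag i)
    covers-e   : ∀ u v → Edge G u v → ∃[ i ] (u ∈ bag i × v ∈ bag i)
    contiguous : ∀ v (i j k : Fin m) → i Data.Fin.≤ j → j Data.Fin.≤ k →
                 v ∈ bag i → v ∈ bag k → v ∈ bag j

open PathDecomposition public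

-- Pathwidth ≤ w : some path decomposition has all bags of size ≤ w + 1
-- (width = max bag size − 1).
PathwidthAtMost : ∀ {n} → Graph n → ℕ → Set
PathwidthAtMost G w =
  ∃[ m ] Σ (PathDecomposition G m) λ P → ∀ i → ∣ bag P i ∣ ≤ w + 1

module Submission where

-- Cut the vertex order after its first c positions.  Edges of one stack and
-- one queue (one of the sq classes) that pass over the cut pairwise neither
-- cross nor nest, so any two of them share an endpoint.  Hence every class has
-- at most one centre at the cut, where a right endpoint is a centre if two left
-- vertices reach it in the class, and a left endpoint w is one if for some edge
-- wy of the class over the cut no other left vertex reaches y in the class.  As
-- the cut moves right only left vertices are added, so w is a centre for an
-- interval of cuts around its position.  The bag at position j consists of the
-- vertex at j and the centres at the cuts j and j + 1: it has at most 2sq + 1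
-- vertices, and every vertex occupies an interval of bags.  An edge uv with u
-- before v is covered at the position j where v first becomes a centre at the
-- cut j + 1, since u then sits at j or is a centre at the cut j; if v never
-- becomes a centre, u is a centre at the cut just before v.

open import Defs hiding (sym)
open import Data.Bool using (true; false)
import Data.Bool.Properties as Bool
open import Data.Empty using (⊥; ⊥-elim)
open import Data.Fin using (Fin; zero; suc; toℕ; fromℕ<; combine; punchOut)
open import Data.Fin.Properties
  using (toℕ-injective; toℕ<n; toℕ-fromℕ<; any?; combine-injective; punchOut-injective; suc-injective)
  renaming (_≟_ to _≟ᶠ_)
open import Data.Fin.Subset using (Subset; _∈_; ∣_∣; _∪_)
open import Data.Fin.Subset.Properties using (x∈p∪q⁺; x∈p∪q⁻)
open import Data.Nat as ℕ using (ℕ; _+_; _*_; _≤_; _<_; z≤n; s≤s; _≤?_; _<?_)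
open import Data.Nat.Properties
  using ( ≤-refl; ≤-trans; <-trans; ≤-<-trans; <-≤-trans; <-irrefl; ≤⇒≯; ≤-total; <-cmp
        ; <⇒≤; m≤n⇒m<n∨m≡n; m<n⇒m<1+n; n<1+n; m≤n⇒m≤1+n; n≤1+n; +-suc; +-mono-≤; +-monoʳ-≤
        ; module ≤-Reasoning)
open import Data.Nat.Tactic.RingSolver using (solve-∀)
open import Data.Product using (∃; ∃₂; _×_; _,_; proj₁; map₂; swap)
open import Data.Sum using (_⊎_; inj₁; inj₂)
open import Data.Vec using (_∷_; []; tabulate)
open import Data.Vec.Properties using (lookup∘tabulate; lookup⇒[]=; []=⇒lookup)
open import Function.Base using (_∘_)
open import Function.Definitions using (Injective)
open import Level using (Level)
open import Relation.Binary.Definitions using (tri<; tri≈; tri>)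
open import Relation.Binary.PropositionalEquality using (_≡_; _≢_; refl; sym; trans; cong; subst)
open import Relation.Nullary using (¬_; Dec; yes; no; does; ¬?; contradiction)
open import Relation.Nullary.Decidable using (_×-dec_; _⊎-dec_; dec-true)
open import Relation.Unary using (Pred; Decidable)

∣p∪q∣≤∣p∣+∣q∣ : ∀ {n} (p q : Subset n) → ∣ p ∪ q ∣ ≤ ∣ p ∣ + ∣ q ∣
∣p∪q∣≤∣p∣+∣q∣ []          []          = z≤n
∣p∪q∣≤∣p∣+∣q∣ (false ∷ p) (false ∷ q) = ∣p∪q∣≤∣p∣+∣q∣ p q
∣p∪q∣≤∣p∣+∣q∣ (true ∷ p)  (false ∷ q) = s≤s (∣p∪q∣≤∣p∣+∣q∣ p q)
∣p∪q∣≤∣p∣+∣q∣ (false ∷ p) (true ∷ q)  =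
  subst (ℕ.suc ∣ p ∪ q ∣ ≤_) (sym (+-suc ∣ p ∣ ∣ q ∣)) (s≤s (∣p∪q∣≤∣p∣+∣q∣ p q))
∣p∪q∣≤∣p∣+∣q∣ (true ∷ p)  (true ∷ q)  =
  s≤s (≤-trans (∣p∪q∣≤∣p∣+∣q∣ p q) (+-monoʳ-≤ ∣ p ∣ (n≤1+n ∣ q ∣)))

module _ {ℓ : Level} where

  select : ∀ {n} {P : Pred (Fin n) ℓ} → Decidable P → Subset n
  select P? = tabulate (does ∘ P?)

  ∈-select⁺ : ∀ {n} {P : Pred (Fin n) ℓ} (P? : Decidable P) {x} → P x → x ∈ select P?
  ∈-select⁺ P? {x} px = lookup⇒[]= x _ (trans (lookup∘tabulate (does ∘ P?) x) (dec-true (P? x) px))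

  ∈-select⁻ : ∀ {n} {P : Pred (Fin n) ℓ} (P? : Decidable P) {x} → x ∈ select P? → P x
  ∈-select⁻ P? {x} x∈ with P? x | trans (sym (lookup∘tabulate (does ∘ P?) x)) ([]=⇒lookup x∈)
  ... | yes px | _ = px
  ... | no _   | ()

  ∣select∣≤ : ∀ {n k} {P : Pred (Fin n) ℓ} (P? : Decidable P) (f : ∀ {x} → P x → Fin k) →
              (∀ {x y} (px : P x) (py : P y) → f px ≡ f py → x ≡ y) → ∣ select P? ∣ ≤ k
  ∣select∣≤ {ℕ.zero} _ _ _ = z≤n
  ∣select∣≤ {ℕ.suc n} P? f f-inj with P? zero
  ... | no _ = ∣select∣≤ (P? ∘ suc) f (λ px py → suc-injective ∘ f-inj px py)
  ∣select∣≤ {ℕ.suc n} {ℕ.zero} P? f f-inj | yes p₀ = contradiction (f p₀) λ ()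
  ∣select∣≤ {ℕ.suc n} {ℕ.suc k} {P} P? f f-inj | yes p₀ = s≤s (∣select∣≤ (P? ∘ suc) g g-inj)
    where
    f₀≢f : ∀ {x} (px : P (suc x)) → f p₀ ≢ f px
    f₀≢f px eq with f-inj p₀ px eq
    ... | ()
    g : ∀ {x} → P (suc x) → Fin k
    g px = punchOut (f₀≢f px)
    g-inj : ∀ {x y} (px : P (suc x)) (py : P (suc y)) → g px ≡ g py → x ≡ y
    g-inj px py = suc-injective ∘ f-inj px py ∘ punchOut-injective (f₀≢f px) (f₀≢f py)

switch-between : ∀ {ℓ : Level} {P : Pred ℕ ℓ} → Decidable P → ∀ {a c} → a ≤ c → ¬ P a → P c →
                 ∃ λ t → a ≤ t × t < c × ¬ P t × P (ℕ.suc t)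
switch-between P? {c = ℕ.zero} z≤n ¬Pa Pc = contradiction Pc ¬Pa
switch-between P? {c = ℕ.suc c} a≤1+c ¬Pa P1+c with m≤n⇒m<n∨m≡n a≤1+c
... | inj₂ refl = contradiction P1+c ¬Pa
... | inj₁ (s≤s a≤c) with P? c
...   | no ¬Pc = c , a≤c , n<1+n c , ¬Pc , P1+c
...   | yes Pc with switch-between P? a≤c ¬Pa Pc
...     | t , a≤t , t<c , ¬Pt , P1+t = t , a≤t , m<n⇒m<1+n t<c , ¬Pt , P1+t

module SimultaneousLayout
  {n s q : ℕ} (G : Graph n) (σ : Fin n → Fin n) (σ-injective : Injective _≡_ _≡_ σ)
  (st : Fin n → Fin n → Fin s) (stacks : IsStackLayout G σ s st)
  (qu : Fin n → Fin n → Fin q) (queues : IsQueueLayout G σ q qu)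
  where

  pos : Fin n → ℕ
  pos = toℕ ∘ σ

  pos-injective : ∀ {x y} → pos x ≡ pos y → x ≡ y
  pos-injective = σ-injective ∘ toℕ-injective

  class : Fin n → Fin n → Fin (s * q)
  class a b = combine (st a b) (qu a b)

  Edge? : ∀ a b → Dec (Edge G a b)
  Edge? a b = adj G a b Bool.≟ true

  Spans : ℕ → Fin n → Fin n → Set
  Spans c a b = Edge G a b × pos a < c × c ≤ pos b

  Spans? : ∀ c a b → Dec (Spans c a b)
  Spans? c a b = Edge? a b ×-dec pos a <? c ×-dec c ≤? pos b

  spanning-sameClass-disjoint : ∀ {c a b a′ b′} → Spans c a b → Spans c a′ b′ →
    class a b ≡ class a′ b′ → a ≢ a′ → b ≢ b′ → ⊥
  spanning-sameClass-disjoint {_} {a} {b} {a′} {b′} (e , a<c , c≤b) (e′ , a′<c , c≤b′)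
                              same a≢a′ b≢b′
    with combine-injective (st a b) (qu a b) (st a′ b′) (qu a′ b′) same
       | <-cmp (pos a) (pos a′) | <-cmp (pos b) (pos b′)
  ... | _ | tri≈ _ a≡a′ _ | _ = a≢a′ (pos-injective a≡a′)
  ... | _ | _ | tri≈ _ b≡b′ _ = b≢b′ (pos-injective b≡b′)
  ... | sameStack , _ | tri< a<a′ _ _ | tri< b<b′ _ _ =
    stacks a b a′ b′ e e′ (a<a′ , <-≤-trans a′<c c≤b , b<b′) sameStack
  ... | _ , sameQueue | tri< a<a′ _ _ | tri> _ _ b′<b =
    queues a b a′ b′ e e′ (a<a′ , <-≤-trans a′<c c≤b′ , b′<b) sameQueue
  ... | _ , sameQueue | tri> _ _ a′<a | tri< b<b′ _ _ =
    queues a′ b′ a b e′ e (a′<a , <-≤-trans a<c c≤b , b<b′) (sym sameQueue)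
  ... | sameStack , _ | tri> _ _ a′<a | tri> _ _ b′<b =
    stacks a′ b′ a b e′ e (a′<a , <-≤-trans a<c c≤b′ , b′<b) (sym sameStack)

  Rival : ℕ → Fin n → Fin n → Set
  Rival c w y = ∃ λ x → x ≢ w × Edge G x y × pos x < c × class x y ≡ class w y

  LeftCentre : ℕ → Fin n → Set
  LeftCentre c w = ∃ λ y → Spans c w y × ¬ Rival c w y

  RightCentre : ℕ → Fin n → Set
  RightCentre c w = ∃₂ λ x x′ → x ≢ x′ × Spans c x w × Spans c x′ w × class x w ≡ class x′ w

  Centre : ℕ → Fin n → Set
  Centre c w = LeftCentre c w ⊎ RightCentre c w

  Rival? : ∀ c w y → Dec (Rival c w y)
  Rival? c w y = any? λ x →
    ¬? (x ≟ᶠ w) ×-dec Edge? x y ×-dec pos x <? c ×-dec class x y ≟ᶠ class w y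

  Centre? : ∀ c w → Dec (Centre c w)
  Centre? c w =
    (any? λ y → Spans? c w y ×-dec ¬? (Rival? c w y)) ⊎-dec
    (any? λ x → any? λ x′ →
      ¬? (x ≟ᶠ x′) ×-dec Spans? c x w ×-dec Spans? c x′ w ×-dec class x w ≟ᶠ class x′ w)

  centreClass : ∀ {c w} → Centre c w → Fin (s * q)
  centreClass {w = w} (inj₁ (y , _)) = class w y
  centreClass {w = w} (inj₂ (x , _)) = class x w

  RightCentre-avoiding : ∀ {c w} (r : RightCentre c w) z →
    ∃ λ a → a ≢ z × Spans c a w × class a w ≡ class (proj₁ r) w
  RightCentre-avoiding (x , x′ , x≢x′ , span , span′ , same) z with x ≟ᶠ z
  ... | yes refl = x′ , x≢x′ ∘ sym , span′ , sym same
  ... | no x≢z   = x , x≢z , span , refl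

  leftCentres-clash : ∀ {c w w′} → w ≢ w′ → (l : LeftCentre c w) (l′ : LeftCentre c w′) →
    class w (proj₁ l) ≢ class w′ (proj₁ l′)
  leftCentres-clash w≢w′ (y , span , unrivalled) (y′ , span′@(e′ , w′<c , _) , _) same
    with y ≟ᶠ y′
  ... | yes refl = unrivalled (_ , w≢w′ ∘ sym , e′ , w′<c , sym same)
  ... | no y≢y′  = spanning-sameClass-disjoint span span′ same w≢w′ y≢y′

  leftRightCentres-clash : ∀ {c w w′} → w ≢ w′ → (l : LeftCentre c w) (r : RightCentre c w′) →
    class w (proj₁ l) ≢ class (proj₁ r) w′
  leftRightCentres-clash {w = w} {w′} w≢w′ (y , span , unrivalled) r same
    with RightCentre-avoiding r w | y ≟ᶠ w′
  ... | a , a≢w , (eᵃ , a<c , _) , sameᵃ | yes refl =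
    unrivalled (a , a≢w , eᵃ , a<c , trans sameᵃ (sym same))
  ... | a , a≢w , spanᵃ , sameᵃ | no y≢w′ =
    spanning-sameClass-disjoint span spanᵃ (trans same (sym sameᵃ)) (a≢w ∘ sym) y≢w′

  rightCentres-clash : ∀ {c w w′} → w ≢ w′ → (r : RightCentre c w) (r′ : RightCentre c w′) →
    class (proj₁ r) w ≢ class (proj₁ r′) w′
  rightCentres-clash w≢w′ r (x′ , _ , _ , span′ , _) same
    with RightCentre-avoiding r x′
  ... | a , a≢x′ , spanᵃ , sameᵃ =
    spanning-sameClass-disjoint spanᵃ span′ (trans sameᵃ same) a≢x′ w≢w′

  centre-unique : ∀ {c w w′} (o : Centre c w) (o′ : Centre c w′) →
    centreClass o ≡ centreClass o′ → w ≡ w′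
  centre-unique {w = w} {w′} o o′ same with w ≟ᶠ w′
  ... | yes w≡w′ = w≡w′
  ... | no w≢w′  = ⊥-elim (clash o o′ same)
    where
    clash : (o : Centre _ w) (o′ : Centre _ w′) → centreClass o ≢ centreClass o′
    clash (inj₁ l) (inj₁ l′) = leftCentres-clash w≢w′ l l′
    clash (inj₁ l) (inj₂ r′) = leftRightCentres-clash w≢w′ l r′
    clash (inj₂ r) (inj₁ l′) = leftRightCentres-clash (w≢w′ ∘ sym) l′ r ∘ sym
    clash (inj₂ r) (inj₂ r′) = rightCentres-clash w≢w′ r r′

  Centre-up : ∀ {c c′ w} → Centre c w → c ≤ c′ → c′ ≤ pos w → Centre c′ w
  Centre-up (inj₁ (_ , (_ , w<c , _) , _)) c≤c′ c′≤w =
    contradiction (<-≤-trans w<c c≤c′) (≤⇒≯ c′≤w)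
  Centre-up (inj₂ (x , x′ , x≢x′ , (e , x<c , _) , (e′ , x′<c , _) , same)) c≤c′ c′≤w =
    inj₂ (x , x′ , x≢x′ , (e , <-≤-trans x<c c≤c′ , c′≤w) ,
          (e′ , <-≤-trans x′<c c≤c′ , c′≤w) , same)

  Centre-down : ∀ {c c′ w} → Centre c w → pos w < c′ → c′ ≤ c → Centre c′ w
  Centre-down (inj₁ (y , (e , _ , c≤y) , unrivalled)) w<c′ c′≤c =
    inj₁ (y , (e , w<c′ , ≤-trans c′≤c c≤y) ,
          λ (x , x≢w , eˣ , x<c′ , same) → unrivalled (x , x≢w , eˣ , <-≤-trans x<c′ c′≤c , same))
  Centre-down (inj₂ (_ , _ , _ , (_ , _ , c≤w) , _)) w<c′ c′≤c =
    contradiction (<-≤-trans w<c′ c′≤c) (≤⇒≯ c≤w)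

  InBag : ℕ → Fin n → Set
  InBag j w = pos w ≡ j ⊎ Centre j w ⊎ Centre (ℕ.suc j) w

  InBag-up : ∀ {i j w} → InBag i w → i ≤ j → j ≤ pos w → InBag j w
  InBag-up b i≤j j≤w with m≤n⇒m<n∨m≡n j≤w
  ... | inj₂ j≡w = inj₁ (sym j≡w)
  ... | inj₁ j<w with b
  ...   | inj₁ w≡i      = contradiction (≤-<-trans i≤j j<w) (<-irrefl (sym w≡i))
  ...   | inj₂ (inj₁ o) = inj₂ (inj₁ (Centre-up o i≤j j≤w))
  ...   | inj₂ (inj₂ o) = inj₂ (inj₂ (Centre-up o (s≤s i≤j) j<w))

  InBag-down : ∀ {j k w} → InBag k w → pos w ≤ j → j ≤ k → InBag j w
  InBag-down b w≤j j≤k with m≤n⇒m<n∨m≡n w≤j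
  ... | inj₂ w≡j = inj₁ w≡j
  ... | inj₁ w<j with b
  ...   | inj₁ w≡k      = contradiction (<-≤-trans w<j j≤k) (<-irrefl w≡k)
  ...   | inj₂ (inj₁ o) = inj₂ (inj₁ (Centre-down o w<j j≤k))
  ...   | inj₂ (inj₂ o) = inj₂ (inj₂ (Centre-down o (m≤n⇒m≤1+n w<j) (s≤s j≤k)))

  centres : ℕ → Subset n
  centres c = select (Centre? c)

  ∣centres∣≤ : ∀ c → ∣ centres c ∣ ≤ s * q
  ∣centres∣≤ c = ∣select∣≤ (Centre? c) centreClass centre-unique

  atPosition : Fin n → Subset n
  atPosition p = select (λ w → σ w ≟ᶠ p)

  ∣atPosition∣≤1 : ∀ p → ∣ atPosition p ∣ ≤ 1
  ∣atPosition∣≤1 p = ∣select∣≤ (λ w → σ w ≟ᶠ p) (λ _ → zero)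
    (λ σw≡p σw′≡p _ → σ-injective (trans σw≡p (sym σw′≡p)))

  bagAt : Fin n → Subset n
  bagAt p = atPosition p ∪ (centres (toℕ p) ∪ centres (ℕ.suc (toℕ p)))

  ∣bagAt∣≤ : ∀ p → ∣ bagAt p ∣ ≤ 2 * s * q + 1
  ∣bagAt∣≤ p = begin
    ∣ bagAt p ∣
      ≤⟨ ∣p∪q∣≤∣p∣+∣q∣ (atPosition p) _ ⟩
    ∣ atPosition p ∣ + ∣ centres (toℕ p) ∪ centres (ℕ.suc (toℕ p)) ∣
      ≤⟨ +-mono-≤ (∣atPosition∣≤1 p) (≤-trans (∣p∪q∣≤∣p∣+∣q∣ (centres _) _)
                                              (+-mono-≤ (∣centres∣≤ _) (∣centres∣≤ _))) ⟩
    1 + (s * q + s * q)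
      ≡⟨ 1+[ab+ab]≡2ab+1 s q ⟩
    2 * s * q + 1 ∎
    where
    open ≤-Reasoning
    1+[ab+ab]≡2ab+1 : ∀ a b → 1 + (a * b + a * b) ≡ 2 * a * b + 1
    1+[ab+ab]≡2ab+1 = solve-∀

  ∈bagAt⁺ : ∀ {p w} → InBag (toℕ p) w → w ∈ bagAt p
  ∈bagAt⁺ (inj₁ w≡p)      = x∈p∪q⁺ (inj₁ (∈-select⁺ (λ w → σ w ≟ᶠ _) (toℕ-injective w≡p)))
  ∈bagAt⁺ (inj₂ (inj₁ o)) = x∈p∪q⁺ (inj₂ (x∈p∪q⁺ (inj₁ (∈-select⁺ (Centre? _) o))))
  ∈bagAt⁺ (inj₂ (inj₂ o)) = x∈p∪q⁺ (inj₂ (x∈p∪q⁺ (inj₂ (∈-select⁺ (Centre? _) o))))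

  ∈bagAt⁻ : ∀ {p w} → w ∈ bagAt p → InBag (toℕ p) w
  ∈bagAt⁻ {p} w∈ with x∈p∪q⁻ (atPosition p) _ w∈
  ... | inj₁ w∈p = inj₁ (cong toℕ (∈-select⁻ (λ w → σ w ≟ᶠ p) w∈p))
  ... | inj₂ w∈c with x∈p∪q⁻ (centres _) _ w∈c
  ...   | inj₁ w∈c₀ = inj₂ (inj₁ (∈-select⁻ (Centre? _) w∈c₀))
  ...   | inj₂ w∈c₁ = inj₂ (inj₂ (∈-select⁻ (Centre? _) w∈c₁))

  bagAt-contiguous : ∀ w (i j k : Fin n) → i Data.Fin.≤ j → j Data.Fin.≤ k →
                     w ∈ bagAt i → w ∈ bagAt k → w ∈ bagAt j
  bagAt-contiguous w i j k i≤j j≤k w∈i w∈k with ≤-total (toℕ j) (pos w)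
  ... | inj₁ j≤w = ∈bagAt⁺ (InBag-up (∈bagAt⁻ w∈i) i≤j j≤w)
  ... | inj₂ w≤j = ∈bagAt⁺ (InBag-down (∈bagAt⁻ w∈k) w≤j j≤k)

  InBag⇒∈bagAt-fromℕ< : ∀ {j w} (j<n : j < n) → InBag j w → w ∈ bagAt (fromℕ< j<n)
  InBag⇒∈bagAt-fromℕ< {w = w} j<n b = ∈bagAt⁺ (subst (λ i → InBag i w) (sym (toℕ-fromℕ< j<n)) b)

  rival⇒RightCentre : ∀ {c u v} → Spans c u v → Rival c u v → RightCentre c v
  rival⇒RightCentre span@(_ , _ , c≤v) (x , x≢u , eˣ , x<c , same) =
    x , _ , x≢u , (eˣ , x<c , c≤v) , span , same

  forwardEdge-inSomeBag : ∀ {u v} → Edge G u v → pos u < pos v →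
    ∃ λ p → u ∈ bagAt p × v ∈ bagAt p
  forwardEdge-inSomeBag {u} {v} e u<v with Rival? (ℕ.suc (pos u)) u v
  ... | yes rival = σ u , ∈bagAt⁺ (inj₁ refl) ,
    ∈bagAt⁺ (inj₂ (inj₂ (inj₂ (rival⇒RightCentre (e , ≤-refl , u<v) rival))))
  ... | no ¬rival with Rival? (pos v) u v
  ...   | no ¬rivalᵛ = σ v , ∈bagAt⁺ (inj₂ (inj₁ (inj₁ (v , (e , u<v , ≤-refl) , ¬rivalᵛ)))) ,
    ∈bagAt⁺ (inj₁ refl)
  ...   | yes rivalᵛ with switch-between (λ c → Rival? c u v) u<v ¬rival rivalᵛ
  ...     | c , u<c , c<v , ¬rivalᶜ , rival¹⁺ᶜ = fromℕ< c<n ,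
    InBag⇒∈bagAt-fromℕ< c<n (inj₂ (inj₁ (inj₁ (v , (e , u<c , <⇒≤ c<v) , ¬rivalᶜ)))) ,
    InBag⇒∈bagAt-fromℕ< c<n
      (inj₂ (inj₂ (inj₂ (rival⇒RightCentre (e , m<n⇒m<1+n u<c , c<v) rival¹⁺ᶜ))))
    where
    c<n : c < n
    c<n = <-trans c<v (toℕ<n (σ v))

  edge-inSomeBag : ∀ u v → Edge G u v → ∃ λ p → u ∈ bagAt p × v ∈ bagAt p
  edge-inSomeBag u v e with <-cmp (pos u) (pos v)
  ... | tri< u<v _ _ = forwardEdge-inSomeBag e u<v
  ... | tri> _ _ v<u = map₂ swap (forwardEdge-inSomeBag (trans (Graph.sym G v u) e) v<u)
  ... | tri≈ _ u≡v _ with pos-injective u≡v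
  ...   | refl = contradiction (trans (sym e) (irrefl G u)) λ ()

  pathDecomposition : PathDecomposition G n
  pathDecomposition = record
    { bag        = bagAt
    ; covers-v   = λ v → σ v , ∈bagAt⁺ (inj₁ refl)
    ; covers-e   = edge-inSomeBag
    ; contiguous = bagAt-contiguous
    }

theorem2 : ∀ {n} (G : Graph n) (s q : ℕ) →
    SimStackQueueLayout G s q → PathwidthAtMost G (2 * s * q)
theorem2 G s q ((σ , σ-injective) , (st , stacks) , (qu , queues)) =
  _ , pathDecomposition , ∣bagAt∣≤
  where open SimultaneousLayout G σ σ-injective st stacks qu queues
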